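{- Let $S$ be a finite transformation semigroup on a finite set, and let $I$ be the minimal ideal of $S$. (1) If $e_1,\dots,e_k$ are representatives of the $\mathcal{R}$-classes of $I$, then $\mathrm{Gr}(S)=\mathrm{Gr}(\{e_1,\dots,e_k\})$. (2) $\mathrm{Gr}(S)=\mathrm{Gr}(E(I))$, where $E(I)$ is the set of idempotents of $I$. (3) $\mathrm{Gr}(S)=\mathrm{Gr}(E(S))$, where $E(S)$ is the set of idempotents of $S$.
   Context: Transformations act on the right. For a set $M$ of transformations of a finite set $V$, $\mathrm{Gr}(M)$ is the graph on $V$ in which distinct $v,w$ are adjacent iff there is no $f\in M$ with $vf=wf$. The minimal ideal of a finite semigroup is its unique minimal two-sided ideal (for transformation semigroups, the elements of minimal rank). Green's relation $\mathcal{R}$ on a semigroup $T$: $f\,\mathcal{R}\,g$ iff $fT^1=gT^1$. -}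

module Defs where

open import Data.Nat using (ℕ; _≤_)
open import Data.Fin using (Fin; _≟_)
open import Data.Fin.Subset using (Subset; ∣_∣)
open import Data.Fin.Properties using (any?)
open import Data.Vec using (tabulate)
open import Data.Product using (Σ; ∃; _×_)
open import Data.Sum using (_⊎_)
open import Relation.Nullary using (¬_; does)
open import Relation.Binary.PropositionalEquality using (_≡_)
open import Function.Bundles using (_⇔_)
open import Level using (0ℓ; suc)

Transf : ℕ → Set
Transf n = Fin n → Fin n

-- Right action: v (f ⨾ g) = (v f) g, i.e. apply f first, then g.
_⨾_ : ∀ {n} → Transf n → Transf n → Transf n
(f ⨾ g) v = g (f v)

_≈_ : ∀ {n} → Transf n → Transf n → Set
f ≈ g = ∀ v → f v ≡ g v

TSet : ℕ → Set₁
TSet n = Transf n → Set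

record TransfSemigroup (n : ℕ) : Set₁ where
  field
    S        : TSet n
    closed   : ∀ {f g} → S f → S g → S (f ⨾ g)
    nonempty : ∃ λ f → S f

image : ∀ {n} → Transf n → Subset n
image f = tabulate (λ j → does (any? (λ i → f i ≟ j)))

rank : ∀ {n} → Transf n → ℕ
rank f = ∣ image f ∣

MinIdeal : ∀ {n} → TSet n → TSet n
MinIdeal S f = S f × (∀ g → S g → rank f ≤ rank g)

-- InRightIdeal h f T: h ∈ f T¹ = {f} ∪ f T.
InRightIdeal : ∀ {n} → Transf n → Transf n → TSet n → Set
InRightIdeal h f T = (h ≈ f) ⊎ (∃ λ t → T t × h ≈ (f ⨾ t))

GreenR : ∀ {n} → TSet n → Transf n → Transf n → Set
GreenR T f g = ∀ h → InRightIdeal h f T ⇔ InRightIdeal h g T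

IsRClassReps : ∀ {n k} → TSet n → (Fin k → Transf n) → Set
IsRClassReps {n} {k} T e =
  (∀ i → T (e i)) ×
  (∀ f → T f → ∃ λ i → GreenR T f (e i)) ×
  (∀ i j → GreenR T (e i) (e j) → i ≡ j)

setOf : ∀ {n k} → (Fin k → Transf n) → TSet n
setOf e f = ∃ λ i → e i ≡ f

E : ∀ {n} → TSet n → TSet n
E T f = T f × ((f ⨾ f) ≈ f)

Adj : ∀ {n} → TSet n → Fin n → Fin n → Set
Adj M v w = ¬ (v ≡ w) × ¬ (∃ λ f → M f × f v ≡ f w)

SameGr : ∀ {n} → TSet n → TSet n → Set
SameGr M N = ∀ v w → Adj M v w ⇔ Adj N v w

module Submission where

-- Gr(M) only records which pairs of points are collapsed by some element
-- of M.  So Gr(S) = Gr(M) for M ⊆ S as soon as every pair collapsed by S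
-- is also collapsed by M.  Because adjacency is a negative statement, it
-- suffices to show this under a double negation, which lets us use the
-- minimal ideal I of S without constructing an element of it.
--
-- Then: a pair collapsed by f ∈ S is collapsed by f ⨾ g ∈ I; it is
-- collapsed by an idempotent power of that element (parts 2, 3); and by
-- the R-class representative of that element (part 1).

open import Defs
open import Data.Nat using (ℕ; zero; suc; _+_; _*_; _∸_; _^_; _≤_; _<_)
open import Data.Nat.Properties using (≤-trans; +-identityʳ; +-comm; +-suc; ≮⇒≥; m+[n∸m]≡n; n<1+n)
open import Data.Nat.Induction using (<-rec)
open import Data.Nat.Tactic.RingSolver using (solve-∀)
open import Data.Fin using (Fin; toℕ; _≟_; funToFin; finToFun)
open import Data.Fin.Properties using (any?; pigeonhole; finToFun-funToFin)
open import Data.Fin.Subset using (_∈_; _⊆_)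
open import Data.Fin.Subset.Properties using (p⊆q⇒∣p∣≤∣q∣)
open import Data.Vec.Properties using ([]=⇒lookup; lookup⇒[]=; lookup∘tabulate)
open import Data.Product using (∃; _×_; _,_; proj₁)
open import Data.Sum using (inj₁; inj₂)
open import Data.Bool using (true)
open import Relation.Nullary using (¬_; Dec; yes; does)
open import Relation.Nullary.Decidable using (dec-true)
open import Relation.Binary.PropositionalEquality
  using (_≡_; refl; sym; trans; cong; module ≡-Reasoning)
open import Function.Bundles using (mk⇔; Equivalence)

module _ {n : ℕ} where

  Collapses : TSet n → Fin n → Fin n → Set
  Collapses M v w = ∃ λ f → M f × f v ≡ f w

  sameGr-by-collapses : (S M : TSet n) → (∀ {f} → M f → S f) →
    (∀ {v w} → Collapses S v w → ¬ ¬ Collapses M v w) → SameGr S M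
  sameGr-by-collapses S M M⊆S back v w = mk⇔
    (λ (v≢w , ¬collS) → v≢w , λ (f , Mf , eq) → ¬collS (f , M⊆S Mf , eq))
    (λ (v≢w , ¬collM) → v≢w , λ collS → back collS ¬collM)

  image⁻ : (f : Transf n) {x : Fin n} → x ∈ image f → ∃ λ i → f i ≡ x
  image⁻ f {x} x∈im = witness (any? (λ i → f i ≟ x))
    (trans (sym (lookup∘tabulate _ x)) ([]=⇒lookup x∈im))
    where
    witness : ∀ {P : Set} (d : Dec P) → does d ≡ true → P
    witness (yes p) _ = p

  image⁺ : (f : Transf n) (i : Fin n) → f i ∈ image f
  image⁺ f i = lookup⇒[]= (f i) (image f)
    (trans (lookup∘tabulate _ (f i)) (dec-true (any? (λ j → f j ≟ f i)) (i , refl)))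

  rank-⨾ : (f g : Transf n) → rank (f ⨾ g) ≤ rank g
  rank-⨾ f g = p⊆q⇒∣p∣≤∣q∣ im⊆im
    where
    im⊆im : image (f ⨾ g) ⊆ image g
    im⊆im x∈im with image⁻ (f ⨾ g) x∈im
    ... | i , refl = image⁺ g (f i)

  rightIdeal-collapses : {T : TSet n} {g h : Transf n} {v w : Fin n} →
    InRightIdeal g h T → h v ≡ h w → g v ≡ g w
  rightIdeal-collapses {v = v} {w} (inj₁ g≈h) hv≡hw =
    trans (g≈h v) (trans hv≡hw (sym (g≈h w)))
  rightIdeal-collapses {v = v} {w} (inj₂ (t , _ , g≈ht)) hv≡hw =
    trans (g≈ht v) (trans (cong t hv≡hw) (sym (g≈ht w)))

  pow : Transf n → ℕ → Transf n
  pow h zero    x = x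
  pow h (suc k) x = pow h k (h x)

  pow-+ : ∀ h a b x → pow h (a + b) x ≡ pow h b (pow h a x)
  pow-+ h zero    b x = refl
  pow-+ h (suc a) b x = pow-+ h a b (h x)

  pow-cong : ∀ h {a b} → a ≡ b → ∀ x → pow h a x ≡ pow h b x
  pow-cong h refl x = refl

  -- Two distinct positive powers of h agree (pigeonhole on the n ^ n
  -- transformations of Fin n).
  powers-repeat : (h : Transf n) →
    ∃ λ a → ∃ λ p → ∀ x → pow h (suc a) x ≡ pow h (suc a + suc p) x
  powers-repeat h with pigeonhole (n<1+n (n ^ n)) (λ k → funToFin (pow h (suc (toℕ k))))
  ... | i , j , i<j , same = toℕ i , toℕ j ∸ suc (toℕ i) , agree
    where
    exponent : suc (toℕ j) ≡ suc (toℕ i) + suc (toℕ j ∸ suc (toℕ i))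
    exponent = cong suc (sym (trans (+-suc (toℕ i) _) (m+[n∸m]≡n i<j)))
    agree : ∀ x → pow h (suc (toℕ i)) x ≡ pow h (suc (toℕ i) + suc (toℕ j ∸ suc (toℕ i))) x
    agree x = begin
      pow h (suc (toℕ i)) x                       ≡⟨ sym (finToFun-funToFin _ x) ⟩
      finToFun (funToFin (pow h (suc (toℕ i)))) x ≡⟨ cong (λ c → finToFun c x) same ⟩
      finToFun (funToFin (pow h (suc (toℕ j)))) x ≡⟨ finToFun-funToFin _ x ⟩
      pow h (suc (toℕ j)) x                       ≡⟨ pow-cong h exponent x ⟩
      _                                           ∎
      where open ≡-Reasoning

  pow-periodic : ∀ h a p → (∀ x → pow h a x ≡ pow h (a + p) x) →
    ∀ t x → pow h a x ≡ pow h (a + t * p) x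
  pow-periodic h a p period zero x = pow-cong h (sym (+-identityʳ a)) x
  pow-periodic h a p period (suc t) x = begin
    pow h a x                         ≡⟨ pow-periodic h a p period t x ⟩
    pow h (a + t * p) x               ≡⟨ pow-cong h (+-comm a (t * p)) x ⟩
    pow h (t * p + a) x               ≡⟨ pow-+ h (t * p) a x ⟩
    pow h a (pow h (t * p) x)         ≡⟨ period (pow h (t * p) x) ⟩
    pow h (a + p) (pow h (t * p) x)   ≡⟨ sym (pow-+ h (t * p) (a + p) x) ⟩
    pow h (t * p + (a + p)) x         ≡⟨ pow-cong h (shuffle a t p) x ⟩
    pow h (a + suc t * p) x           ∎
    where
    open ≡-Reasoning
    shuffle : ∀ a t p → t * p + (a + p) ≡ a + (p + t * p)
    shuffle = solve-∀

  -- Every transformation of a finite set has an idempotent positive power: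
  -- if h^A = h^(A+P) with A, P ≥ 1, then m = P·A is at least A, so
  -- h^(2m) = h^((m - A) + A + A·P) = h^((m - A) + A) = h^m.
  idempotent-power : (h : Transf n) → ∃ λ k → (pow h (suc k) ⨾ pow h (suc k)) ≈ pow h (suc k)
  idempotent-power h with powers-repeat h
  ... | a , p , period = a + p * suc a , idem
    where
    m = suc a + p * suc a
    idem : ∀ x → pow h m (pow h m x) ≡ pow h m x
    idem x = begin
      pow h m (pow h m x)                               ≡⟨ sym (pow-+ h m m x) ⟩
      pow h (m + m) x                                   ≡⟨ pow-cong h (double a p) x ⟩
      pow h (p * suc a + (suc a + suc a * suc p)) x     ≡⟨ pow-+ h (p * suc a) _ x ⟩
      pow h (suc a + suc a * suc p) (pow h (p * suc a) x)
        ≡⟨ sym (pow-periodic h (suc a) (suc p) period (suc a) _) ⟩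
      pow h (suc a) (pow h (p * suc a) x)               ≡⟨ sym (pow-+ h (p * suc a) (suc a) x) ⟩
      pow h (p * suc a + suc a) x                       ≡⟨ pow-cong h (+-comm (p * suc a) (suc a)) x ⟩
      pow h m x                                         ∎
      where
      open ≡-Reasoning
      double : ∀ a p → (suc a + p * suc a) + (suc a + p * suc a)
                         ≡ p * suc a + (suc a + suc a * suc p)
      double = solve-∀

module _ {n : ℕ} (𝒮 : TransfSemigroup n) where
  open TransfSemigroup 𝒮

  minIdeal-absorbs : ∀ {f g} → S f → MinIdeal S g → MinIdeal S (f ⨾ g)
  minIdeal-absorbs {f} {g} Sf (Sg , g-min) =
    closed Sf Sg , λ h Sh → ≤-trans (rank-⨾ f g) (g-min h Sh)

  minIdeal-pow : ∀ {h} → MinIdeal S h → ∀ k → MinIdeal S (pow h (suc k))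
  minIdeal-pow Ih zero    = Ih
  minIdeal-pow Ih (suc k) = minIdeal-absorbs (proj₁ Ih) (minIdeal-pow Ih k)

  -- The minimal ideal is nonempty, up to double negation (S is an arbitrary
  -- predicate, so no minimal element can be computed).  By well-founded
  -- induction on rank: if no element of smaller rank leads to a minimal
  -- element, then the current element is itself minimal.
  minIdeal-nonempty : ¬ ¬ ∃ (MinIdeal S)
  minIdeal-nonempty noMin with nonempty
  ... | f , Sf = <-rec LeadsToMin step (rank f) f Sf refl noMin
    where
    LeadsToMin : ℕ → Set
    LeadsToMin r = ∀ g → S g → rank g ≡ r → ¬ ¬ ∃ (MinIdeal S)
    step : ∀ r → (∀ {r′} → r′ < r → LeadsToMin r′) → LeadsToMin r
    step _ smaller g Sg refl noMin′ =
      noMin′ (g , Sg , λ h Sh → ≮⇒≥ λ h<g → smaller h<g h Sh refl noMin′)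

  collapse-by-minIdeal : ∀ {v w} → Collapses S v w → ¬ ¬ Collapses (MinIdeal S) v w
  collapse-by-minIdeal (f , Sf , fv≡fw) ¬collI = minIdeal-nonempty λ (g , Ig) →
    ¬collI (f ⨾ g , minIdeal-absorbs Sf Ig , cong g fv≡fw)

  collapse-by-idempotent : ∀ {v w} → Collapses (MinIdeal S) v w → Collapses (E (MinIdeal S)) v w
  collapse-by-idempotent (h , Ih , hv≡hw) with idempotent-power h
  ... | k , idem = pow h (suc k) , (minIdeal-pow Ih k , idem) , cong (pow h k) hv≡hw

  -- Pairs collapsed by the minimal ideal are collapsed by any system of
  -- R-class representatives: h R eᵢ gives eᵢ ∈ h I¹.
  collapse-by-reps : ∀ {k} (e : Fin k → Transf n) → IsRClassReps (MinIdeal S) e →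
    ∀ {v w} → Collapses (MinIdeal S) v w → Collapses (setOf e) v w
  collapse-by-reps e (_ , covered , _) (h , Ih , hv≡hw) with covered h Ih
  ... | i , h~eᵢ = e i , (i , refl) ,
    rightIdeal-collapses (Equivalence.from (h~eᵢ (e i)) (inj₁ λ _ → refl)) hv≡hw

mainTheorem13 : (n : ℕ) (𝒮 : TransfSemigroup n) →
    let S = TransfSemigroup.S 𝒮
        I = MinIdeal S
    in ((k : ℕ) (e : Fin k → Transf n) → IsRClassReps I e → SameGr S (setOf e))
       × SameGr S (E I)
       × SameGr S (E S)
mainTheorem13 n 𝒮 = part1 , part2 , part3
  where
  open TransfSemigroup 𝒮
  part1 : (k : ℕ) (e : Fin k → Transf n) → IsRClassReps (MinIdeal S) e → SameGr S (setOf e)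
  part1 k e reps@(e-in-I , _) =
    sameGr-by-collapses S (setOf e) (λ { (i , refl) → proj₁ (e-in-I i) })
      λ collS ¬coll → collapse-by-minIdeal 𝒮 collS
        λ collI → ¬coll (collapse-by-reps 𝒮 e reps collI)
  part2 : SameGr S (E (MinIdeal S))
  part2 = sameGr-by-collapses S (E (MinIdeal S)) (λ ((Sf , _) , _) → Sf)
    λ collS ¬coll → collapse-by-minIdeal 𝒮 collS
      λ collI → ¬coll (collapse-by-idempotent 𝒮 collI)
  part3 : SameGr S (E S)
  part3 = sameGr-by-collapses S (E S) proj₁
    λ collS ¬coll → collapse-by-minIdeal 𝒮 collS λ collI →
      let (f , ((Sf , _) , idem) , fv≡fw) = collapse-by-idempotent 𝒮 collI
      in ¬coll (f , (Sf , idem) , fv≡fw)
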